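{- Let $F$ be a graph of diameter $2$ with $n=|V(F)|$ and minimum degree $t=\delta(F)\ge 2$, and let $l>n$ be an integer. Let $A_{2l-1}$ be the graph with vertex set $\{1,\dots,2l-1\}$ in which distinct $i,j$ are adjacent iff $|i-j|\le l-1$, and let $F_{2l}$ be obtained from $A_{2l-1}$ by adding a vertex $2l$ and the edges $(1,2l),\dots,(t,2l)$. For $v\in\{1,\dots,2l-1\}$ let $\delta_v=f_v-z_v$, where $z_v$ and $f_v$ are the $F$-degrees of $v$ in $A_{2l-1}$ and $F_{2l}$, respectively. Then $\delta_i<\delta_l$ for every $i\in\{l+1,l+2,\dots,l+t-1\}$.
   Context: All graphs are finite, simple and undirected. For graphs $F$ and $G$ and a vertex $v$ of $G$, the $F$-degree of $v$ in $G$ is the number of subgraphs of $G$ (not necessarily induced) that are isomorphic to $F$ and contain $v$. $\delta(F)$ is the minimum vertex degree of $F$. -}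

module Defs where

open import Data.Bool using (Bool; true; false; _∧_; _∨_; if_then_else_; T)
open import Data.Nat using (ℕ; zero; suc; _+_; _*_; _∸_; _≤_; _<_; _⊓_; _≤ᵇ_; _<ᵇ_)
import Data.Nat as ℕ
open import Data.Fin using (Fin; toℕ)
import Data.Fin as Fin
open import Data.List using (List; []; _∷_; map; length; filter; concatMap; foldr; allFin)
open import Data.Bool.ListAction using (any; all)
import Data.List as List
open import Data.Vec using (Vec; tabulate; lookup)
import Data.Vec.Properties as VecP
import Data.Product.Properties as ProdP
open import Data.Bool.Properties using () renaming (_≟_ to _≟B_)
open import Data.Product using (_×_; _,_; Σ; ∃)
open import Relation.Binary.PropositionalEquality using (_≡_; _≢_)
open import Relation.Nullary using (¬_)
open import Relation.Nullary.Decidable using (⌊_⌋)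

Graph : ℕ → Set
Graph n = Fin n → Fin n → Bool

IsSimple : ∀ {n} → Graph n → Set
IsSimple {n} G = (∀ i j → G i j ≡ G j i) × (∀ i → G i i ≡ false)

-- vertex degree and minimum degree δ(G) (for n = 0 the value is 0)
deg : ∀ {n} → Graph n → Fin n → ℕ
deg {n} G v = length (filter (λ u → T? (G v u)) (allFin n))
  where open import Data.Bool.Properties using (T?)

minDeg : ∀ {n} → Graph n → ℕ
minDeg {n} G = foldr _⊓_ n (map (deg G) (allFin n))

Dist≤2 : ∀ {n} → Graph n → Fin n → Fin n → Set
Dist≤2 {n} G u v = u ≡ v ⊎' (G u v ≡ true ⊎' ∃ λ w → G u w ≡ true × G w v ≡ true)
  where open import Data.Sum using () renaming (_⊎_ to _⊎'_)

-- diameter exactly 2: all distances are ≤ 2 and some pair is at distance 2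
-- (distinct, non-adjacent, hence at distance exactly 2)
HasDiameter2 : ∀ {n} → Graph n → Set
HasDiameter2 {n} G = (∀ u v → Dist≤2 G u v)
                   × ∃ λ u → ∃ λ v → u ≢ v × G u v ≡ false

-- The subgraphs of G
-- isomorphic to F are exactly the images (f(V(F)), f(E(F))) of the injective
-- maps f : V(F) → V(G) sending edges of F to edges of G.

Subgraph : ℕ → Set
Subgraph m = Vec Bool m × Vec (Vec Bool m) m

_==_ : ∀ {m} → Fin m → Fin m → Bool
x == y = ⌊ x Fin.≟ y ⌋

allMaps : (n m : ℕ) → List (Vec (Fin m) n)
allMaps zero    m = Vec.[] ∷ []
  where import Data.Vec as Vec
allMaps (suc n) m = concatMap (λ x → map (x Vec.∷_) (allMaps n m)) (allFin m)
  where import Data.Vec as Vec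

isEmbedding : ∀ {n m} → Graph n → Graph m → Vec (Fin m) n → Bool
isEmbedding {n} F G f =
  all (λ a → all (λ b →
        (if a == b then true else Data.Bool.not (lookup f a == lookup f b))
      ∧ (if F a b then G (lookup f a) (lookup f b) else true))
    (allFin n)) (allFin n)
  where import Data.Bool

image : ∀ {n m} → Graph n → Vec (Fin m) n → Subgraph m
image {n} F f =
  tabulate (λ x → any (λ a → lookup f a == x) (allFin n)) ,
  tabulate (λ x → tabulate (λ y →
     any (λ a → any (λ b → F a b ∧ (lookup f a == x) ∧ (lookup f b == y))
            (allFin n)) (allFin n)))

_≟S_ : ∀ {m} (S T : Subgraph m) → Relation.Nullary.Dec (S ≡ T)
_≟S_ = ProdP.≡-dec (VecP.≡-dec _≟B_) (VecP.≡-dec (VecP.≡-dec _≟B_))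
  where import Relation.Nullary

copies : ∀ {n m} → Graph n → Graph m → List (Subgraph m)
copies {n} {m} F G =
  List.deduplicate _≟S_
    (map (image F) (filter (λ f → T? (isEmbedding F G f)) (allMaps n m)))
  where open import Data.Bool.Properties using (T?)

-- The graphs A_{2l-1} and F_{2l}.  Vertex with label i (1-based) is the
-- element of Fin with toℕ equal to i - 1.

closeℕ : ℕ → ℕ → ℕ → Bool
closeℕ k i j = Data.Bool.not (i ℕ.≡ᵇ j) ∧ ((i ∸ j) ≤ᵇ k) ∧ ((j ∸ i) ≤ᵇ k)
  where import Data.Bool

A : (l : ℕ) → Graph (2 * l ∸ 1)
A l i j = closeℕ (l ∸ 1) (toℕ i) (toℕ j)

F2l : (l t : ℕ) → Graph (2 * l)
F2l l t i j =
  if (toℕ i ℕ.≡ᵇ (2 * l ∸ 1)) then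
    (if (toℕ j ℕ.≡ᵇ (2 * l ∸ 1)) then false else (toℕ j <ᵇ t))
  else (if (toℕ j ℕ.≡ᵇ (2 * l ∸ 1)) then (toℕ i <ᵇ t)
        else closeℕ (l ∸ 1) (toℕ i) (toℕ j))

FdegAt : ∀ {n m} → Graph n → Graph m → ℕ → ℕ
FdegAt F G i = length (filter (λ S → T? (hasLabel S)) (copies F G))
  where open import Data.Bool.Properties using (T?)
        import Data.Product
        hasLabel : _ → Bool
        hasLabel S = any (λ x → lookup (Data.Product.proj₁ S) x ∧ (suc (toℕ x) ℕ.≡ᵇ i)) (allFin _)

open import Data.Integer using (ℤ; +_; _-_)

δ : ∀ {n} → Graph n → (l t v : ℕ) → ℤ
δ F l t v = + FdegAt F (F2l l t) v - + FdegAt F (A l) v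

-- Copies of F in F2l that avoid the new vertex 2l are exactly the copies of F in A, so δ_v is
-- the number of copies of F through both v and 2l.  Let l < i < l + t.  The vertex l is adjacent
-- to every vertex of A, while i is not adjacent to 2l; hence exchanging i and l turns a copy
-- through i and 2l that misses l into a copy through l and 2l, and keeping the copies that
-- already contain l this injects the copies through i into those through l.  The injection is
-- not onto: send a vertex w of minimum degree t to 2l, its neighbours into 1, …, t and the other
-- vertices into 1, …, l, with an edge x y (x ∼ w ≁ y) landing on 1 l.  This copy avoids i, and a
-- preimage would need the edge 1 i, which A lacks since i - 1 ≥ l.

module Submission where

open import Defs
open import Data.Nat using (ℕ; _+_; _∸_; _≤_; _<_)
open import Data.Integer using () renaming (_<_ to _<ℤ_)
open import Relation.Binary.PropositionalEquality using (_≡_)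

open import Data.Bool using (Bool; true; false; _∧_; not; T; if_then_else_)
open import Data.Bool.Properties using (T?; T-∧; T-≡; T-not-≡)
open import Data.Bool.ListAction using (any; all)
open import Data.Empty using (⊥-elim)
open import Data.Fin using (Fin; toℕ; fromℕ; fromℕ<; inject₁; lower₁)
import Data.Fin as Fin
open import Data.Fin.Permutation.Components using (transpose; transpose-inverse)
open import Data.Fin.Properties
  using ( toℕ-injective; toℕ-fromℕ; toℕ-fromℕ<; toℕ-inject₁; toℕ-inject₁-≢; inject₁-injective; inject₁-lower₁
        ; toℕ<n; ≤fromℕ )
open import Data.Integer using (+_; _-_; +<+)
open import Data.Integer.Properties using ([+m]-[+n]≡m⊖n; ≤-⊖)
open import Data.List using (List; []; _∷_; map; length; filter; allFin)
import Data.List as List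
open import Data.List.Properties using (length-map; length-tabulate; filter-≐; foldr-forcesᵇ)
open import Data.List.Membership.Propositional using (_∈_; lose)
open import Data.List.Membership.Propositional.Properties
  using ( ∈-filter⁺; ∈-filter⁻; ∈-map⁺; ∈-map⁻; ∈-allFin; ∈-concat⁺′; ∈-deduplicate⁺; ∈-deduplicate⁻
        ; foldr-selective )
open import Data.List.Relation.Unary.All as All using (All; []; _∷_)
import Data.List.Relation.Unary.All.Properties as All
open import Data.List.Relation.Unary.All.Properties using (all⁺; all⁻)
open import Data.List.Relation.Unary.AllPairs as AllPairs using ([]; _∷_)
open import Data.List.Relation.Unary.Any as Any using (here; there; index)
open import Data.List.Relation.Unary.Any.Properties using (any⁺; any⁻; lookup-index)
open import Data.List.Relation.Unary.Unique.Propositional using (Unique)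
import Data.List.Relation.Unary.Unique.Propositional.Properties as Unique
open import Data.List.Relation.Unary.Unique.DecPropositional.Properties using (deduplicate-!)
open import Data.Nat using (zero; suc; _*_; _≡ᵇ_; _<ᵇ_; z≤n; s≤s; s≤s⁻¹)
open import Data.Nat.Properties
open import Data.Product using (_×_; _,_; ∃; ∃₂; proj₁; proj₂)
open import Data.Sum using (_⊎_; inj₁; inj₂)
open import Data.Unit using (tt)
open import Data.Vec using (Vec; lookup; tabulate; []; _∷_)
import Data.Vec as Vec
open import Data.Vec.Properties using (lookup∘tabulate; tabulate∘lookup; tabulate-cong; lookup-map)
open import Function.Bundles using (Equivalence)
open import Function.Definitions using (Injective)
open import Relation.Binary.PropositionalEquality
  using (_≢_; refl; sym; trans; cong; cong₂; subst; subst₂; module ≡-Reasoning)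
open import Relation.Nullary using (¬_; yes; no)
open import Relation.Nullary.Decidable
  using (toWitness; fromWitness; toWitnessFalse; fromWitnessFalse; dec-true; dec-false)

open Equivalence using (to; from)

private variable n m k : ℕ

T-not⁺ : ∀ {b} → ¬ T b → T (not b)
T-not⁺ {false} _   = tt
T-not⁺ {true}  ¬tt = ¬tt tt

T-not⁻ : ∀ {b} → T (not b) → ¬ T b
T-not⁻ {false} _ ()

T-extensional : ∀ {a b} → (T a → T b) → (T b → T a) → a ≡ b
T-extensional {false} {false} _ _ = refl
T-extensional {false} {true}  _ b⇒a = ⊥-elim (b⇒a tt)
T-extensional {true}  {false} a⇒b _ = ⊥-elim (a⇒b tt)
T-extensional {true}  {true}  _ _ = refl

T-if : ∀ {c x} → (T c → T x) → T (if c then x else true)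
T-if {true}  h = h tt
T-if {false} _ = tt

T-if⁻ : ∀ {c x} → T (if c then x else true) → T c → T x
T-if⁻ {true} h _ = h

T-any⁺ : (p : Fin n → Bool) (a : Fin n) → T (p a) → T (any p (allFin n))
T-any⁺ p a pa = any⁺ p (lose (∈-allFin a) pa)

T-any⁻ : {X : Set} (p : X → Bool) (xs : List X) → T (any p xs) → ∃ λ a → T (p a)
T-any⁻ p xs h = Any.satisfied (any⁻ p xs h)

==⇒≡ : {x y : Fin n} → T (x == y) → x ≡ y
==⇒≡ = toWitness

==-refl : (x : Fin n) → T (x == x)
==-refl x = fromWitness refl

-- Counting along injections

count : {X : Set} → (X → Bool) → List X → ℕ
count p xs = length (filter (λ x → T? (p x)) xs)

_∈_∣_ : {X : Set} → X → List X → (X → Bool) → Set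
x ∈ xs ∣ p = x ∈ xs × T (p x)

module _ {X : Set} {p : X → Bool} {xs : List X} where

  ∈-count⁺ : ∀ {x} → x ∈ xs ∣ p → x ∈ filter (λ x → T? (p x)) xs
  ∈-count⁺ (x∈ , px) = ∈-filter⁺ (λ x → T? (p x)) x∈ px

  ∈-count⁻ : ∀ {x} → x ∈ filter (λ x → T? (p x)) xs → x ∈ xs ∣ p
  ∈-count⁻ = ∈-filter⁻ (λ x → T? (p x))

count-split : {X : Set} (p r : X → Bool) (xs : List X) →
              count p xs ≡ count (λ x → p x ∧ not (r x)) xs + count (λ x → p x ∧ r x) xs
count-split p r [] = refl
count-split p r (x ∷ xs) with p x | r x
... | false | _     = count-split p r xs
... | true  | false = cong suc (count-split p r xs)
... | true  | true  = trans (cong suc (count-split p r xs)) (sym (+-suc _ _))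

module _ {X : Set} where

  private
    _─_ : (ys : List X) {z : X} → z ∈ ys → List X
    (y ∷ ys) ─ here _   = ys
    (y ∷ ys) ─ there p  = y ∷ (ys ─ p)

    length-─ : ∀ ys {z} (p : z ∈ ys) → suc (length (ys ─ p)) ≡ length ys
    length-─ (y ∷ ys) (here _)  = refl
    length-─ (y ∷ ys) (there p) = cong suc (length-─ ys p)

    ∈-─ : ∀ ys {z x} (p : z ∈ ys) → x ∈ ys → z ≢ x → x ∈ ys ─ p
    ∈-─ (y ∷ ys) (here refl) (here refl) z≢x = ⊥-elim (z≢x refl)
    ∈-─ (y ∷ ys) (here refl) (there q)   _   = q
    ∈-─ (y ∷ ys) (there p)   (here refl) _   = here refl
    ∈-─ (y ∷ ys) (there p)   (there q)   z≢x = there (∈-─ ys p q z≢x)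

  unique-⊆⇒length≤ : ∀ {xs ys : List X} → Unique xs → (∀ {x} → x ∈ xs → x ∈ ys) → length xs ≤ length ys
  unique-⊆⇒length≤ {[]}     _              _  = z≤n
  unique-⊆⇒length≤ {x ∷ xs} {ys} (x∉xs ∷ u) xs⊆ys =
    subst (_ ≤_) (length-─ ys (xs⊆ys (here refl)))
      (s≤s (unique-⊆⇒length≤ u λ x′∈xs →
        ∈-─ ys _ (xs⊆ys (there x′∈xs)) (All.lookup x∉xs x′∈xs)))

  map-unique : {Y : Set} (h : X → Y) {xs : List X} → Unique xs →
               (∀ {x y} → x ∈ xs → y ∈ xs → h x ≡ h y → x ≡ y) → Unique (map h xs)
  map-unique h {[]}     []         _   = []
  map-unique h {x ∷ xs} (x∉ ∷ u) inj =
    All.map⁺ (All.tabulate λ y∈ hx≡hy → All.lookup x∉ y∈ (inj (here refl) (there y∈) hx≡hy))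
    ∷ map-unique h u (λ x∈ y∈ → inj (there x∈) (there y∈))

module _ {X Y : Set} {p : X → Bool} {q : Y → Bool} {xs : List X} {ys : List Y} (h : X → Y)
         (unique : Unique xs)
         (maps-into : ∀ {x} → x ∈ xs ∣ p → h x ∈ ys ∣ q)
         (injective : ∀ {x x′} → x ∈ xs ∣ p → x′ ∈ xs ∣ p → h x ≡ h x′ → x ≡ x′) where

  private
    mapped : List Y
    mapped = map h (filter (λ x → T? (p x)) xs)

    length-mapped : length mapped ≡ count p xs
    length-mapped = length-map h (filter (λ x → T? (p x)) xs)

    mapped-unique : Unique mapped
    mapped-unique = map-unique h (Unique.filter⁺ (λ x → T? (p x)) unique)
      (λ x∈ x′∈ → injective (∈-count⁻ x∈) (∈-count⁻ x′∈))

    mapped⊆ : ∀ {y} → y ∈ mapped → y ∈ filter (λ y → T? (q y)) ys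
    mapped⊆ y∈ with ∈-map⁻ h y∈
    ... | x , x∈ , refl = ∈-count⁺ (maps-into (∈-count⁻ x∈))

  count-≤-injection : count p xs ≤ count q ys
  count-≤-injection = subst (_≤ count q ys) length-mapped (unique-⊆⇒length≤ mapped-unique mapped⊆)

  count-<-injection : ∀ {y₀} → y₀ ∈ ys ∣ q → (∀ {x} → x ∈ xs ∣ p → h x ≢ y₀) → count p xs < count q ys
  count-<-injection {y₀} y₀∈ missed =
    subst (λ k → suc k ≤ count q ys) length-mapped
      (unique-⊆⇒length≤ (All.tabulate y₀∉ ∷ mapped-unique)
        λ { (here refl) → ∈-count⁺ y₀∈ ; (there y∈) → mapped⊆ y∈ })
    where
    y₀∉ : ∀ {y} → y ∈ mapped → y₀ ≢ y
    y₀∉ y∈ refl with ∈-map⁻ h y∈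
    ... | x , x∈ , hx≡y₀ = missed (∈-count⁻ x∈) (sym hx≡y₀)

  count-≡-bijection : Unique ys → (∀ {y} → y ∈ ys ∣ q → ∃ λ x → x ∈ xs ∣ p × h x ≡ y) →
                      count p xs ≡ count q ys
  count-≡-bijection unique-ys onto = ≤-antisym count-≤-injection
    (subst (count q ys ≤_) length-mapped
      (unique-⊆⇒length≤ (Unique.filter⁺ (λ y → T? (q y)) unique-ys) ⊆mapped))
    where
    ⊆mapped : ∀ {y} → y ∈ filter (λ y → T? (q y)) ys → y ∈ mapped
    ⊆mapped y∈ with onto (∈-count⁻ y∈)
    ... | x , x∈ , refl = ∈-map⁺ h (∈-count⁺ x∈)

count-cong : {X : Set} {p q : X → Bool} → (∀ x → p x ≡ q x) → (xs : List X) → count p xs ≡ count q xs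
count-cong {p = p} {q} p≗q xs =
  cong length (filter-≐ (λ x → T? (p x)) (λ x → T? (q x))
    ((λ {x} → subst T (p≗q x)) , (λ {x} → subst T (sym (p≗q x)))) xs)

count-complement : {X : Set} (p : X → Bool) (xs : List X) → count (λ x → not (p x)) xs + count p xs ≡ length xs
count-complement p xs = trans (sym (count-split (λ _ → true) p xs)) (count-true xs)
  where
  count-true : ∀ xs → count (λ _ → true) xs ≡ length xs
  count-true []       = refl
  count-true (x ∷ xs) = cong suc (count-true xs)

-- Copies of F

module _ {G : Graph m} (G-simple : IsSimple G) where

  simple⇒sym : ∀ {a b} → T (G a b) → T (G b a)
  simple⇒sym {a} {b} = subst T (proj₁ G-simple a b)

  simple⇒irrefl : ∀ {a} → ¬ T (G a a)
  simple⇒irrefl {a} = subst T (proj₂ G-simple a)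

record IsEmbedding (F : Graph n) (G : Graph m) (f : Vec (Fin m) n) : Set where
  field
    injective : Injective _≡_ _≡_ (lookup f)
    adjacent  : ∀ {a b} → T (F a b) → T (G (lookup f a) (lookup f b))

private
  T-unless : ∀ {a b : Fin n} {x} → (a ≢ b → T x) → T (if a == b then true else x)
  T-unless {a = a} {b} h with a Fin.≟ b
  ... | yes _   = tt
  ... | no a≢b = h a≢b

  T-unless⁻ : ∀ {a b : Fin n} {x} → T (if a == b then true else x) → a ≢ b → T x
  T-unless⁻ {a = a} {b} h a≢b with a Fin.≟ b
  ... | yes a≡b = ⊥-elim (a≢b a≡b)
  ... | no _    = h

  embeddingCondition : (F : Graph n) (G : Graph m) (f : Vec (Fin m) n) → Fin n → Fin n → Bool
  embeddingCondition F G f a b =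
    (if a == b then true else not (lookup f a == lookup f b)) ∧
    (if F a b then G (lookup f a) (lookup f b) else true)

isEmbedding⁺ : (F : Graph n) (G : Graph m) (f : Vec (Fin m) n) → IsEmbedding F G f → T (isEmbedding F G f)
isEmbedding⁺ {n} F G f emb =
  all⁻ (λ a → all (embeddingCondition F G f a) (allFin n)) {allFin n} (All.tabulate λ {a} _ →
    all⁻ (embeddingCondition F G f a) {allFin n} (All.tabulate λ {b} _ → condition a b))
  where
  open IsEmbedding emb
  condition : ∀ a b → T (embeddingCondition F G f a b)
  condition a b = from T-∧
    ( T-unless {x = not (lookup f a == lookup f b)} (λ a≢b → fromWitnessFalse (λ fa≡fb → a≢b (injective fa≡fb)))
    , T-if adjacent )

isEmbedding⁻ : (F : Graph n) (G : Graph m) (f : Vec (Fin m) n) → T (isEmbedding F G f) → IsEmbedding F G f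
isEmbedding⁻ {n} F G f h = record
  { injective = λ {a} {b} → injective a b
  ; adjacent  = λ {a} {b} → T-if⁻ (proj₂ (condition a b))
  }
  where
  condition : ∀ a b → T (if a == b then true else not (lookup f a == lookup f b))
                    × T (if F a b then G (lookup f a) (lookup f b) else true)
  condition a b = to T-∧ (All.lookup (all⁺ (embeddingCondition F G f a) (allFin n)
    (All.lookup (all⁺ (λ a → all (embeddingCondition F G f a) (allFin n)) (allFin n) h) (∈-allFin a))) (∈-allFin b))
  injective : ∀ a b → lookup f a ≡ lookup f b → a ≡ b
  injective a b fa≡fb with a Fin.≟ b
  ... | yes a≡b = a≡b
  ... | no a≢b  = ⊥-elim (toWitnessFalse (T-unless⁻ (proj₁ (condition a b)) a≢b) fa≡fb)

∈-allMaps : (f : Vec (Fin m) n) → f ∈ allMaps n m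
∈-allMaps {m} {zero}  []      = here refl
∈-allMaps {m} {suc n} (x ∷ f) =
  ∈-concat⁺′ (∈-map⁺ (x ∷_) (∈-allMaps f)) (∈-map⁺ (λ x → map (x ∷_) (allMaps n m)) (∈-allFin x))

copies-unique : (F : Graph n) (G : Graph m) → Unique (copies F G)
copies-unique F G = deduplicate-! _≟S_ _

∈-copies⁺ : {F : Graph n} {G : Graph m} {f : Vec (Fin m) n} → IsEmbedding F G f → image F f ∈ copies F G
∈-copies⁺ {n} {m} {F} {G} {f} emb =
  ∈-deduplicate⁺ _≟S_ (∈-map⁺ (image F) (∈-count⁺ (∈-allMaps f , isEmbedding⁺ F G f emb)))

∈-copies⁻ : (F : Graph n) (G : Graph m) {S : Subgraph m} → S ∈ copies F G →
            ∃ λ f → IsEmbedding F G f × S ≡ image F f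
∈-copies⁻ {n} {m} F G S∈ with ∈-map⁻ (image F) (∈-deduplicate⁻ _≟S_ _ S∈)
... | f , f∈ , S≡ = f , isEmbedding⁻ F G f (proj₂ (∈-count⁻ {xs = allMaps n m} f∈)) , S≡

hasVertex : Subgraph m → Fin m → Bool
hasVertex S x = lookup (proj₁ S) x

hasEdge : Subgraph m → Fin m → Fin m → Bool
hasEdge S x y = lookup (lookup (proj₂ S) x) y

subgraph-ext : {S S′ : Subgraph m} → (∀ x → hasVertex S x ≡ hasVertex S′ x) →
               (∀ x y → hasEdge S x y ≡ hasEdge S′ x y) → S ≡ S′
subgraph-ext {S = V , E} {V′ , E′} V≗V′ E≗E′ =
  cong₂ _,_ (vec-ext V≗V′) (vec-ext (λ x → vec-ext (E≗E′ x)))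
  where
  vec-ext : ∀ {X : Set} {k} {u v : Vec X k} → (∀ i → lookup u i ≡ lookup v i) → u ≡ v
  vec-ext {u = u} {v} u≗v = trans (sym (tabulate∘lookup u)) (trans (tabulate-cong u≗v) (tabulate∘lookup v))

module _ (F : Graph n) (f : Vec (Fin m) n) where

  image-vertex⁺ : ∀ a → T (hasVertex (image F f) (lookup f a))
  image-vertex⁺ a = subst T (sym (lookup∘tabulate _ (lookup f a)))
    (T-any⁺ (λ b → lookup f b == lookup f a) a (==-refl (lookup f a)))

  image-vertex⁻ : ∀ {x} → T (hasVertex (image F f) x) → ∃ λ a → lookup f a ≡ x
  image-vertex⁻ {x} h with T-any⁻ _ (allFin n) (subst T (lookup∘tabulate _ x) h)
  ... | a , fa==x = a , ==⇒≡ fa==x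

  private
    lookup-edges : ∀ x y → hasEdge (image F f) x y
      ≡ any (λ a → any (λ b → F a b ∧ (lookup f a == x) ∧ (lookup f b == y)) (allFin n)) (allFin n)
    lookup-edges x y = trans (cong (λ row → lookup row y) (lookup∘tabulate _ x)) (lookup∘tabulate _ y)

  image-edge⁺ : ∀ {a b} → T (F a b) → T (hasEdge (image F f) (lookup f a) (lookup f b))
  image-edge⁺ {a} {b} Fab = subst T (sym (lookup-edges _ _))
    (T-any⁺ _ a (T-any⁺ _ b
      (from (T-∧ {F a b}) (Fab , from (T-∧ {lookup f a == lookup f a}) (==-refl _ , ==-refl _)))))

  image-edge⁻ : ∀ {x y} → T (hasEdge (image F f) x y) →
                ∃₂ λ a b → T (F a b) × lookup f a ≡ x × lookup f b ≡ y
  image-edge⁻ {x} {y} h with T-any⁻ _ (allFin n) (subst T (lookup-edges x y) h)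
  ... | a , h′ with T-any⁻ _ (allFin n) h′
  ... | b , h″ with to T-∧ h″
  ... | Fab , h‴ with to T-∧ h‴
  ... | fa==x , fb==y = a , b , Fab , ==⇒≡ fa==x , ==⇒≡ fb==y

Fdeg : Graph n → Graph m → Fin m → ℕ
Fdeg F G x = count (λ S → hasVertex S x) (copies F G)

Fdeg₂ : Graph n → Graph m → Fin m → Fin m → ℕ
Fdeg₂ F G x y = count (λ S → hasVertex S x ∧ hasVertex S y) (copies F G)

FdegAt≡Fdeg : (F : Graph n) (G : Graph m) {i : ℕ} {x : Fin m} → suc (toℕ x) ≡ i → FdegAt F G i ≡ Fdeg F G x
FdegAt≡Fdeg {m = m} F G {i} {x} x-labelled-i =
  count-cong (λ S → T-extensional (labelled⇒ S) (labelled⇐ S)) (copies F G)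
  where
  labelled⇒ : ∀ S → T (any (λ y → hasVertex S y ∧ (suc (toℕ y) ≡ᵇ i)) (allFin m)) → T (hasVertex S x)
  labelled⇒ S h with T-any⁻ _ (allFin m) h
  ... | y , Sy∧y-labelled-i with to T-∧ Sy∧y-labelled-i
  ... | Sy , y-labelled-i =
    subst (λ z → T (hasVertex S z))
      (toℕ-injective (suc-injective (trans (≡ᵇ⇒≡ _ _ y-labelled-i) (sym x-labelled-i)))) Sy

  labelled⇐ : ∀ S → T (hasVertex S x) → T (any (λ y → hasVertex S y ∧ (suc (toℕ y) ≡ᵇ i)) (allFin m))
  labelled⇐ S Sx = T-any⁺ _ x (from T-∧ (Sx , ≡⇒≡ᵇ _ _ x-labelled-i))

-- Relabelling subgraphs

pullback : (Fin k → Fin m) → Subgraph m → Subgraph k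
pullback φ S = tabulate (λ x → hasVertex S (φ x)) , tabulate (λ x → tabulate (λ y → hasEdge S (φ x) (φ y)))

module _ (φ : Fin k → Fin m) (S : Subgraph m) where

  hasVertex-pullback : ∀ x → hasVertex (pullback φ S) x ≡ hasVertex S (φ x)
  hasVertex-pullback x = lookup∘tabulate _ x

  hasEdge-pullback : ∀ x y → hasEdge (pullback φ S) x y ≡ hasEdge S (φ x) (φ y)
  hasEdge-pullback x y = trans (cong (λ row → lookup row y) (lookup∘tabulate _ x)) (lookup∘tabulate _ y)

pullback-image : (F : Graph n) (φ : Fin k → Fin m) → (∀ {x y} → φ x ≡ φ y → x ≡ y) →
                 (f : Vec (Fin m) n) (g : Vec (Fin k) n) → (∀ a → lookup f a ≡ φ (lookup g a)) →
                 pullback φ (image F f) ≡ image F g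
pullback-image F φ φ-injective f g f≗φ∘g = subgraph-ext
  (λ x → trans (hasVertex-pullback φ (image F f) x) (T-extensional (vertex⇒ x) (vertex⇐ x)))
  (λ x y → trans (hasEdge-pullback φ (image F f) x y) (T-extensional (edge⇒ x y) (edge⇐ x y)))
  where
  to-g : ∀ a x → lookup f a ≡ φ x → lookup g a ≡ x
  to-g a x fa≡φx = φ-injective (trans (sym (f≗φ∘g a)) fa≡φx)
  to-f : ∀ a x → lookup g a ≡ x → lookup f a ≡ φ x
  to-f a x ga≡x = trans (f≗φ∘g a) (cong φ ga≡x)

  vertex⇒ : ∀ x → T (hasVertex (image F f) (φ x)) → T (hasVertex (image F g) x)
  vertex⇒ x h with image-vertex⁻ F f h
  ... | a , fa≡ = subst (λ z → T (hasVertex (image F g) z)) (to-g a x fa≡) (image-vertex⁺ F g a)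

  vertex⇐ : ∀ x → T (hasVertex (image F g) x) → T (hasVertex (image F f) (φ x))
  vertex⇐ x h with image-vertex⁻ F g h
  ... | a , ga≡ = subst (λ z → T (hasVertex (image F f) z)) (to-f a x ga≡) (image-vertex⁺ F f a)

  edge⇒ : ∀ x y → T (hasEdge (image F f) (φ x) (φ y)) → T (hasEdge (image F g) x y)
  edge⇒ x y h with image-edge⁻ F f h
  ... | a , b , Fab , fa≡ , fb≡ =
    subst₂ (λ u v → T (hasEdge (image F g) u v)) (to-g a x fa≡) (to-g b y fb≡) (image-edge⁺ F g Fab)

  edge⇐ : ∀ x y → T (hasEdge (image F g) x y) → T (hasEdge (image F f) (φ x) (φ y))
  edge⇐ x y h with image-edge⁻ F g h
  ... | a , b , Fab , ga≡ , gb≡ =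
    subst₂ (λ u v → T (hasEdge (image F f) u v)) (to-f a x ga≡) (to-f b y gb≡) (image-edge⁺ F f Fab)

private
  module Transfer (F : Graph n) (φ : Fin k → Fin m) {f₁ f₂ : Vec (Fin m) n} {g₁ g₂ : Vec (Fin k) n}
                  (f₁≗φ∘g₁ : ∀ a → lookup f₁ a ≡ φ (lookup g₁ a))
                  (f₂≗φ∘g₂ : ∀ a → lookup f₂ a ≡ φ (lookup g₂ a))
                  (g₁≡g₂ : image F g₁ ≡ image F g₂) where

    vertex : ∀ x → T (hasVertex (image F f₁) x) → T (hasVertex (image F f₂) x)
    vertex x h with image-vertex⁻ F f₁ h
    ... | a , refl
        with image-vertex⁻ F g₂ (subst (λ S → T (hasVertex S (lookup g₁ a))) g₁≡g₂ (image-vertex⁺ F g₁ a))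
    ... | a′ , g₂a′≡g₁a = subst (λ z → T (hasVertex (image F f₂) z))
            (trans (f₂≗φ∘g₂ a′) (trans (cong φ g₂a′≡g₁a) (sym (f₁≗φ∘g₁ a)))) (image-vertex⁺ F f₂ a′)

    edge : ∀ x y → T (hasEdge (image F f₁) x y) → T (hasEdge (image F f₂) x y)
    edge x y h with image-edge⁻ F f₁ h
    ... | a , b , Fab , refl , refl
        with image-edge⁻ F g₂
               (subst (λ S → T (hasEdge S (lookup g₁ a) (lookup g₁ b))) g₁≡g₂ (image-edge⁺ F g₁ Fab))
    ... | a′ , b′ , Fa′b′ , g₂a′≡ , g₂b′≡ = subst₂ (λ u v → T (hasEdge (image F f₂) u v))
            (trans (f₂≗φ∘g₂ a′) (trans (cong φ g₂a′≡) (sym (f₁≗φ∘g₁ a))))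
            (trans (f₂≗φ∘g₂ b′) (trans (cong φ g₂b′≡) (sym (f₁≗φ∘g₁ b)))) (image-edge⁺ F f₂ Fa′b′)

image-factor-cong : (F : Graph n) (φ : Fin k → Fin m) (f f′ : Vec (Fin m) n) (g g′ : Vec (Fin k) n) →
                    (∀ a → lookup f a ≡ φ (lookup g a)) → (∀ a → lookup f′ a ≡ φ (lookup g′ a)) →
                    image F g ≡ image F g′ → image F f ≡ image F f′
image-factor-cong F φ f f′ g g′ f≗ f′≗ g≡g′ = subgraph-ext
  (λ x → T-extensional (There.vertex x) (Back.vertex x))
  (λ x y → T-extensional (There.edge x y) (Back.edge x y))
  where
  module There = Transfer F φ {f} {f′} {g} {g′} f≗ f′≗ g≡g′
  module Back  = Transfer F φ {f′} {f} {g′} {g} f′≗ f≗ (sym g≡g′)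

pullback-inverse : (φ : Fin k → Fin m) (ψ : Fin m → Fin k) → (∀ x → φ (ψ x) ≡ x) →
                   ∀ S → pullback ψ (pullback φ S) ≡ S
pullback-inverse φ ψ φ∘ψ≗id S = subgraph-ext
  (λ x → trans (hasVertex-pullback ψ (pullback φ S) x)
    (trans (hasVertex-pullback φ S (ψ x)) (cong (hasVertex S) (φ∘ψ≗id x))))
  (λ x y → trans (hasEdge-pullback ψ (pullback φ S) x y)
    (trans (hasEdge-pullback φ S (ψ x) (ψ y)) (cong₂ (hasEdge S) (φ∘ψ≗id x) (φ∘ψ≗id y))))

-- Adding a vertex

module _ {F : Graph n} {G : Graph m} {H : Graph k} (φ : Fin k → Fin m) (φ-injective : ∀ {x y} → φ x ≡ φ y → x ≡ y)
         (φ-induces : ∀ x y → G (φ x) (φ y) ≡ H x y) (f : Vec (Fin m) n) (g : Vec (Fin k) n)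
         (f≗φ∘g : ∀ a → lookup f a ≡ φ (lookup g a)) where

  embedding-restrict : IsEmbedding F G f → IsEmbedding F H g
  embedding-restrict emb = record
    { injective = λ ga≡gb → injective (trans (f≗φ∘g _) (trans (cong φ ga≡gb) (sym (f≗φ∘g _))))
    ; adjacent  = λ {a} {b} Fab → subst T (trans (cong₂ G (f≗φ∘g a) (f≗φ∘g b)) (φ-induces _ _)) (adjacent Fab)
    }
    where open IsEmbedding emb

  embedding-extend : IsEmbedding F H g → IsEmbedding F G f
  embedding-extend emb = record
    { injective = λ fa≡fb → injective (φ-injective (trans (sym (f≗φ∘g _)) (trans fa≡fb (f≗φ∘g _))))
    ; adjacent  = λ {a} {b} Fab →
        subst T (sym (trans (cong₂ G (f≗φ∘g a) (f≗φ∘g b)) (φ-induces _ _))) (adjacent Fab)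
    }
    where open IsEmbedding emb

module _ (F : Graph n) (G : Graph (suc k)) (H : Graph k)
         (G-extends-H : ∀ x y → G (inject₁ x) (inject₁ y) ≡ H x y) where

  private
    new : Fin (suc k)
    new = fromℕ k

    record FactorsThroughH (S : Subgraph (suc k)) : Set where
      constructor factors
      field
        f       : Vec (Fin (suc k)) n
        g       : Vec (Fin k) n
        g-emb   : IsEmbedding F H g
        S≡image : S ≡ image F f
        f≗ι∘g   : ∀ a → lookup f a ≡ inject₁ (lookup g a)

    copy-avoiding-new : ∀ {S} → S ∈ copies F G → ¬ T (hasVertex S new) → FactorsThroughH S
    copy-avoiding-new S∈ S∌new with ∈-copies⁻ F G S∈
    ... | f , emb , S≡image =
      factors f g (embedding-restrict inject₁ inject₁-injective G-extends-H f g f≗ι∘g emb) S≡image f≗ι∘g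
      where
      k≢f : ∀ a → k ≢ toℕ (lookup f a)
      k≢f a k≡fa = S∌new (subst₂ (λ S z → T (hasVertex S z)) (sym S≡image)
                     (toℕ-injective (trans (sym k≡fa) (sym (toℕ-fromℕ k)))) (image-vertex⁺ F f a))
      g : Vec (Fin k) n
      g = tabulate (λ a → lower₁ (lookup f a) (k≢f a))
      f≗ι∘g : ∀ a → lookup f a ≡ inject₁ (lookup g a)
      f≗ι∘g a = sym (trans (cong inject₁ (lookup∘tabulate _ a)) (inject₁-lower₁ _ (k≢f a)))

  Fdeg-extension : ∀ x → Fdeg F G (inject₁ x) ≡ Fdeg F H x + Fdeg₂ F G (inject₁ x) new
  Fdeg-extension x = trans (count-split (λ S → hasVertex S (inject₁ x)) (λ S → hasVertex S new) (copies F G))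
    (cong (_+ Fdeg₂ F G (inject₁ x) new)
      (count-≡-bijection (pullback inject₁) (copies-unique F G) maps-into injective (copies-unique F H) onto))
    where
    Avoiding : Subgraph (suc k) → Bool
    Avoiding S = hasVertex S (inject₁ x) ∧ not (hasVertex S new)

    decompose : ∀ {S} → S ∈ copies F G ∣ Avoiding → FactorsThroughH S
    decompose (S∈ , h) = copy-avoiding-new S∈ (T-not⁻ (proj₂ (to T-∧ h)))

    maps-into : ∀ {S} → S ∈ copies F G ∣ Avoiding → pullback inject₁ S ∈ copies F H ∣ (λ S → hasVertex S x)
    maps-into {S} S∈ =
      subst (_∈ copies F H)
        (sym (trans (cong (pullback inject₁) S≡image) (pullback-image F inject₁ inject₁-injective f g f≗ι∘g)))
        (∈-copies⁺ g-emb) ,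
      subst T (sym (hasVertex-pullback inject₁ S x)) (proj₁ (to T-∧ (proj₂ S∈)))
      where open FactorsThroughH (decompose S∈)

    injective : ∀ {S S′} → S ∈ copies F G ∣ Avoiding → S′ ∈ copies F G ∣ Avoiding →
                pullback inject₁ S ≡ pullback inject₁ S′ → S ≡ S′
    injective {S} {S′} S∈ S′∈ S↓≡S′↓ =
      trans S.S≡image
        (trans (image-factor-cong F inject₁ S.f S′.f S.g S′.g S.f≗ι∘g S′.f≗ι∘g images-below) (sym S′.S≡image))
      where
      module S  = FactorsThroughH (decompose S∈)
      module S′ = FactorsThroughH (decompose S′∈)
      open ≡-Reasoning
      images-below : image F S.g ≡ image F S′.g
      images-below = begin
        image F S.g                       ≡⟨ pullback-image F inject₁ inject₁-injective S.f S.g S.f≗ι∘g ⟨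
        pullback inject₁ (image F S.f)    ≡⟨ cong (pullback inject₁) S.S≡image ⟨
        pullback inject₁ S                ≡⟨ S↓≡S′↓ ⟩
        pullback inject₁ S′               ≡⟨ cong (pullback inject₁) S′.S≡image ⟩
        pullback inject₁ (image F S′.f)   ≡⟨ pullback-image F inject₁ inject₁-injective S′.f S′.g S′.f≗ι∘g ⟩
        image F S′.g                      ∎

    onto : ∀ {R} → R ∈ copies F H ∣ (λ S → hasVertex S x) →
           ∃ λ S → S ∈ copies F G ∣ Avoiding × pullback inject₁ S ≡ R
    onto {R} (R∈ , R∋x) with ∈-copies⁻ F H R∈
    ... | g , emb , R≡image =
      image F ιg , (∈-copies⁺ (embedding-extend {G = G} inject₁ inject₁-injective G-extends-H ιg g ιg≗ emb) ,
                    from T-∧ (has-ιx , T-not⁺ avoids-new)) ,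
      trans ιg↓≡ (sym R≡image)
      where
      ιg = Vec.map inject₁ g
      ιg≗ : ∀ a → lookup ιg a ≡ inject₁ (lookup g a)
      ιg≗ a = lookup-map a inject₁ g
      ιg↓≡ : pullback inject₁ (image F ιg) ≡ image F g
      ιg↓≡ = pullback-image F inject₁ inject₁-injective ιg g ιg≗
      has-ιx : T (hasVertex (image F ιg) (inject₁ x))
      has-ιx = subst T (trans (cong (λ S → hasVertex S x) (trans R≡image (sym ιg↓≡)))
                             (hasVertex-pullback inject₁ (image F ιg) x)) R∋x
      avoids-new : ¬ T (hasVertex (image F ιg) new)
      avoids-new h with image-vertex⁻ F ιg h
      ... | a , ιga≡new = toℕ-inject₁-≢ (lookup g a)
        (sym (trans (cong toℕ (trans (sym (ιg≗ a)) ιga≡new)) (toℕ-fromℕ k)))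

-- Exchanging two vertices

module _ (i j : Fin m) where

  transpose-fixes : ∀ {k} → k ≢ i → k ≢ j → transpose i j k ≡ k
  transpose-fixes {k} k≢i k≢j rewrite dec-false (k Fin.≟ i) k≢i | dec-false (k Fin.≟ j) k≢j = refl

  transpose-sends-i : transpose i j i ≡ j
  transpose-sends-i rewrite dec-true (i Fin.≟ i) refl = refl

  transpose-sends-j : transpose i j j ≡ i
  transpose-sends-j with j Fin.≟ i
  ... | yes j≡i = j≡i
  ... | no _ rewrite dec-true (j Fin.≟ j) refl = refl

module _ (F : Graph n) (G : Graph m) (G-simple : IsSimple G) {p q z w : Fin m}
         (z≢p : z ≢ p) (z≢q : z ≢ q) (w≢p : w ≢ p) (w≢q : w ≢ q)
         (q-dominates-p : ∀ y → y ≢ q → T (G p y) → T (G q y)) (p≁z : ¬ T (G p z))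
         {S₀ : Subgraph m} (S₀∈ : S₀ ∈ copies F G) (S₀∋q : T (hasVertex S₀ q)) (S₀∋w : T (hasVertex S₀ w))
         (S₀∌p : ¬ T (hasVertex S₀ p)) (S₀∋qz : T (hasEdge S₀ q z)) where

  private
    σ σ⁻¹ : Fin m → Fin m
    σ   = transpose p q
    σ⁻¹ = transpose q p

    σ∘σ⁻¹≗id : ∀ x → σ (σ⁻¹ x) ≡ x
    σ∘σ⁻¹≗id x = transpose-inverse p q

    σ⁻¹∘σ≗id : ∀ x → σ⁻¹ (σ x) ≡ x
    σ⁻¹∘σ≗id x = transpose-inverse q p

    σ-injective : ∀ {x y} → σ x ≡ σ y → x ≡ y
    σ-injective {x} {y} σx≡σy = trans (sym (σ⁻¹∘σ≗id x)) (trans (cong σ⁻¹ σx≡σy) (σ⁻¹∘σ≗id y))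

    σ⁻¹-adjacent : ∀ {u v} → u ≢ q → v ≢ q → T (G u v) → T (G (σ⁻¹ u) (σ⁻¹ v))
    σ⁻¹-adjacent {u} {v} u≢q v≢q Guv with u Fin.≟ p | v Fin.≟ p
    ... | yes refl | yes refl = ⊥-elim (simple⇒irrefl G-simple Guv)
    ... | yes refl | no v≢p   = subst₂ (λ a b → T (G a b))
        (sym (transpose-sends-j q p)) (sym (transpose-fixes q p v≢q v≢p)) (q-dominates-p v v≢q Guv)
    ... | no u≢p   | yes refl = subst₂ (λ a b → T (G a b))
        (sym (transpose-fixes q p u≢q u≢p)) (sym (transpose-sends-j q p))
        (simple⇒sym G-simple (q-dominates-p u u≢q (simple⇒sym G-simple Guv)))
    ... | no u≢p   | no v≢p   = subst₂ (λ a b → T (G a b))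
        (sym (transpose-fixes q p u≢q u≢p)) (sym (transpose-fixes q p v≢q v≢p)) Guv

    swap : Subgraph m → Subgraph m
    swap S = if hasVertex S q then S else pullback σ S

    Through : Fin m → Subgraph m → Bool
    Through x S = hasVertex S x ∧ hasVertex S w

    σ-p : ∀ S → hasVertex (pullback σ S) p ≡ hasVertex S q
    σ-p S = trans (hasVertex-pullback σ S p) (cong (hasVertex S) (transpose-sends-i p q))

    σ-q : ∀ S → hasVertex (pullback σ S) q ≡ hasVertex S p
    σ-q S = trans (hasVertex-pullback σ S q) (cong (hasVertex S) (transpose-sends-j p q))

    σ-w : ∀ S → hasVertex (pullback σ S) w ≡ hasVertex S w
    σ-w S = trans (hasVertex-pullback σ S w) (cong (hasVertex S) (transpose-fixes p q w≢p w≢q))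

    swapped-copy : ∀ {S} → S ∈ copies F G → ¬ T (hasVertex S q) → pullback σ S ∈ copies F G
    swapped-copy S∈ S∌q with ∈-copies⁻ F G S∈
    ... | f , emb , S≡image = subst (_∈ copies F G)
            (sym (trans (cong (pullback σ) S≡image) (pullback-image F σ σ-injective f g f≗σ∘g)))
            (∈-copies⁺ g-embedding)
      where
      open IsEmbedding emb
      g = Vec.map σ⁻¹ f
      f≗σ∘g : ∀ a → lookup f a ≡ σ (lookup g a)
      f≗σ∘g a = sym (trans (cong σ (lookup-map a σ⁻¹ f)) (σ∘σ⁻¹≗id _))
      f≢q : ∀ a → lookup f a ≢ q
      f≢q a fa≡q = S∌q (subst₂ (λ X x → T (hasVertex X x)) (sym S≡image) fa≡q (image-vertex⁺ F f a))
      g-embedding : IsEmbedding F G g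
      g-embedding = record
        { injective = λ {a} {b} ga≡gb → injective (trans (f≗σ∘g a) (trans (cong σ ga≡gb) (sym (f≗σ∘g b))))
        ; adjacent  = λ {a} {b} Fab → subst₂ (λ u v → T (G u v)) (sym (lookup-map a σ⁻¹ f)) (sym (lookup-map b σ⁻¹ f))
                        (σ⁻¹-adjacent (f≢q a) (f≢q b) (adjacent Fab))
        }

  Fdeg₂-dominated<dominating : Fdeg₂ F G p w < Fdeg₂ F G q w
  Fdeg₂-dominated<dominating =
    count-<-injection swap (copies-unique F G) maps-into injective (S₀∈ , from T-∧ (S₀∋q , S₀∋w)) misses-S₀
    where
    maps-into : ∀ {S} → S ∈ copies F G ∣ Through p → swap S ∈ copies F G ∣ Through q
    maps-into {S} (S∈ , S∋p∧w) with to T-∧ S∋p∧w | hasVertex S q in S∋q?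
    ... | _ , S∋w   | true  = S∈ , from T-∧ (from T-≡ S∋q? , S∋w)
    ... | S∋p , S∋w | false = swapped-copy S∈ (λ S∋q → subst T S∋q? S∋q) ,
                              from T-∧ (subst T (sym (σ-q S)) S∋p , subst T (sym (σ-w S)) S∋w)

    injective : ∀ {S S′} → S ∈ copies F G ∣ Through p → S′ ∈ copies F G ∣ Through p →
                swap S ≡ swap S′ → S ≡ S′
    injective {S} {S′} (_ , S∋p∧w) (_ , S′∋p∧w) swapS≡swapS′
      with hasVertex S q in S∋q? | hasVertex S′ q in S′∋q?
    ... | true  | true  = swapS≡swapS′
    ... | false | false = trans (sym (pullback-inverse σ σ⁻¹ σ∘σ⁻¹≗id S))
                            (trans (cong (pullback σ⁻¹) swapS≡swapS′) (pullback-inverse σ σ⁻¹ σ∘σ⁻¹≗id S′))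
    ... | true  | false = ⊥-elim (subst T (trans (cong (λ X → hasVertex X p) swapS≡swapS′) (trans (σ-p S′) S′∋q?))
                                    (proj₁ (to T-∧ S∋p∧w)))
    ... | false | true  = ⊥-elim (subst T (trans (cong (λ X → hasVertex X p) (sym swapS≡swapS′)) (trans (σ-p S) S∋q?))
                                    (proj₁ (to T-∧ S′∋p∧w)))

    misses-S₀ : ∀ {S} → S ∈ copies F G ∣ Through p → swap S ≢ S₀
    misses-S₀ {S} (S∈ , S∋p∧w) swapS≡S₀ with hasVertex S q in S∋q?
    ... | true  = S₀∌p (subst (λ X → T (hasVertex X p)) swapS≡S₀ (proj₁ (to T-∧ S∋p∧w)))
    ... | false with ∈-copies⁻ F G S∈
    ... | f , emb , S≡image with image-edge⁻ F f (subst (λ X → T (hasEdge X p z)) S≡image S∋pz)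
      where
      S∋pz : T (hasEdge S p z)
      S∋pz = subst T (trans (cong (λ X → hasEdge X q z) (sym swapS≡S₀))
                       (trans (hasEdge-pullback σ S q z)
                              (cong₂ (hasEdge S) (transpose-sends-j p q) (transpose-fixes p q z≢p z≢q))))
                 S₀∋qz
    ... | a , b , Fab , refl , refl = p≁z (IsEmbedding.adjacent emb Fab)

-- Minimum degree and induced cherries

module _ (F : Graph n) where

  minDeg≤deg : ∀ v → minDeg F ≤ deg F v
  minDeg≤deg v = All.lookup
    (foldr-forcesᵇ (λ a b m≤a⊓b → m≤n⊓o⇒m≤n a b m≤a⊓b , m≤n⊓o⇒m≤o a b m≤a⊓b)
                   n (map (deg F) (allFin n)) ≤-refl)
    (∈-map⁺ (deg F) (∈-allFin v))

  minDeg-attained : minDeg F < n → ∃ λ w → deg F w ≡ minDeg F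
  minDeg-attained minDeg<n with foldr-selective ⊓-sel n (map (deg F) (allFin n))
  ... | inj₁ minDeg≡n = ⊥-elim (<-irrefl minDeg≡n minDeg<n)
  ... | inj₂ minDeg∈ with ∈-map⁻ (deg F) minDeg∈
  ... | w , _ , minDeg≡deg = w , sym minDeg≡deg

  non-neighbours+deg≡n : ∀ u → count (λ v → not (F u v)) (allFin n) + deg F u ≡ n
  non-neighbours+deg≡n u = trans (count-complement (F u) (allFin n)) (length-tabulate (λ v → v))

  non-adjacent⇒deg+2≤n : IsSimple F → ∀ {u v} → u ≢ v → ¬ T (F u v) → deg F u + 2 ≤ n
  non-adjacent⇒deg+2≤n F-simple {u} {v} u≢v u≁v =
    subst (deg F u + 2 ≤_) (trans (+-comm (deg F u) _) (non-neighbours+deg≡n u))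
      (+-monoʳ-≤ (deg F u) (unique-⊆⇒length≤ ((u≢v All.∷ All.[]) ∷ (All.[] ∷ [])) u,v⊆))
    where
    u,v⊆ : ∀ {a} → a ∈ u ∷ v ∷ [] → a ∈ filter (λ b → T? (not (F u b))) (allFin n)
    u,v⊆ (here refl)         = ∈-count⁺ (∈-allFin u , T-not⁺ (simple⇒irrefl F-simple))
    u,v⊆ (there (here refl)) = ∈-count⁺ (∈-allFin v , T-not⁺ u≁v)

two-distinct : (p : Fin n → Bool) → 2 ≤ count p (allFin n) → ∃₂ λ b c → T (p b) × T (p c) × b ≢ c
two-distinct {n} p two≤ with filter (λ b → T? (p b)) (allFin n) in eq
two-distinct p (s≤s ()) | _ ∷ []
... | b ∷ c ∷ _ = b , c , member (here refl) , member (there (here refl)) , All.head (AllPairs.head unique)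
  where
  member : ∀ {d} → d ∈ b ∷ c ∷ _ → T (p d)
  member d∈ = proj₂ (∈-count⁻ {xs = allFin n} (subst (_ ∈_) (sym eq) d∈))
  unique : Unique (b ∷ c ∷ _)
  unique = subst Unique eq (Unique.filter⁺ (λ b → T? (p b)) (Unique.allFin⁺ n))

another-vertex : (p : Fin n → Bool) → 2 ≤ count p (allFin n) → (a : Fin n) → ∃ λ b → T (p b) × b ≢ a
another-vertex p two≤ a with two-distinct p two≤
... | b , c , pb , pc , b≢c with a Fin.≟ b
...   | yes refl = c , pc , λ c≡a → b≢c (sym c≡a)
...   | no a≢b   = b , pb , λ b≡a → a≢b (sym b≡a)

record InducedCherry (F : Graph n) (t : ℕ) : Set where
  field
    w x y  : Fin n
    w∼x    : T (F w x)
    x∼y    : T (F x y)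
    w≁y    : ¬ T (F w y)
    y≢w    : y ≢ w
    deg≤t  : deg F w ≤ t

module _ (F : Graph n) (F-simple : IsSimple F) (F-diameter-2 : HasDiameter2 F) where

  private
    far-pair : ∃₂ λ u v → u ≢ v × ¬ T (F u v)
    far-pair with proj₂ F-diameter-2
    ... | u , v , u≢v , u≁v = u , v , u≢v , λ Fuv → subst T u≁v Fuv

  minDeg+2≤n : minDeg F + 2 ≤ n
  minDeg+2≤n with far-pair
  ... | u , v , u≢v , u≁v = ≤-trans (+-monoˡ-≤ 2 (minDeg≤deg F u)) (non-adjacent⇒deg+2≤n F F-simple u≢v u≁v)

  minimum-degree-cherry : InducedCherry F (minDeg F)
  minimum-degree-cherry with minDeg-attained F (<-≤-trans (m<m+n (minDeg F) (s≤s z≤n)) minDeg+2≤n)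
  ... | w , deg≡minDeg with another-vertex (λ b → not (F w b)) two-non-neighbours w
    where
    two-non-neighbours : 2 ≤ count (λ b → not (F w b)) (allFin n)
    two-non-neighbours = +-cancelˡ-≤ (deg F w) 2 _ (subst (deg F w + 2 ≤_)
      (trans (sym (non-neighbours+deg≡n F w)) (+-comm _ (deg F w)))
      (subst (λ d → d + 2 ≤ n) (sym deg≡minDeg) minDeg+2≤n))
  ... | y , w≁y , y≢w with proj₁ F-diameter-2 w y
  ...   | inj₁ w≡y                  = ⊥-elim (y≢w (sym w≡y))
  ...   | inj₂ (inj₁ w∼y)           = ⊥-elim (T-not⁻ w≁y (from T-≡ w∼y))
  ...   | inj₂ (inj₂ (x , w∼x , x∼y)) = record
    { w = w ; x = x ; y = y ; w∼x = from T-≡ w∼x ; x∼y = from T-≡ x∼y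
    ; w≁y = T-not⁻ w≁y ; y≢w = y≢w ; deg≤t = ≤-reflexive deg≡minDeg }

-- The graphs A and F2l

private
  ≡ᵇ-refl : ∀ a → (a ≡ᵇ a) ≡ true
  ≡ᵇ-refl a = dec-true (a ≟ a) refl

  ≡ᵇ-false : ∀ {a b} → a ≢ b → (a ≡ᵇ b) ≡ false
  ≡ᵇ-false {a} {b} = dec-false (a ≟ b)

module _ {k a b : ℕ} where

  closeℕ⁺ : a ≢ b → a ∸ b ≤ k → b ∸ a ≤ k → T (closeℕ k a b)
  closeℕ⁺ a≢b a∸b≤k b∸a≤k =
    from T-∧ (T-not⁺ (λ a≡ᵇb → a≢b (≡ᵇ⇒≡ a b a≡ᵇb)) , from T-∧ (≤⇒≤ᵇ a∸b≤k , ≤⇒≤ᵇ b∸a≤k))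

  closeℕ⁻ : T (closeℕ k a b) → a ≢ b × a ∸ b ≤ k × b ∸ a ≤ k
  closeℕ⁻ h with to T-∧ h
  ... | a≢ᵇb , h′ with to T-∧ h′
  ... | a∸b≤ᵇk , b∸a≤ᵇk =
    (λ a≡b → T-not⁻ a≢ᵇb (≡⇒≡ᵇ a b a≡b)) , ≤ᵇ⇒≤ _ _ a∸b≤ᵇk , ≤ᵇ⇒≤ _ _ b∸a≤ᵇk

closeℕ-sym : ∀ k a b → closeℕ k a b ≡ closeℕ k b a
closeℕ-sym k a b = T-extensional (flip-close a b) (flip-close b a)
  where
  flip-close : ∀ a b → T (closeℕ k a b) → T (closeℕ k b a)
  flip-close a b h with closeℕ⁻ {k} {a} {b} h
  ... | a≢b , a∸b≤k , b∸a≤k = closeℕ⁺ {k} {b} {a} (λ b≡a → a≢b (sym b≡a)) b∸a≤k a∸b≤k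

closeℕ-irrefl : ∀ k a → closeℕ k a a ≡ false
closeℕ-irrefl k a = to T-not-≡ (T-not⁺ (λ h → proj₁ (closeℕ⁻ {k} {a} {a} h) refl))

module _ (l′ t : ℕ) where

  private
    l = suc l′
    G = F2l l t

  apex : Fin (2 * l)
  apex = fromℕ (2 * l ∸ 1)

  2l∸1≡l′+l : 2 * l ∸ 1 ≡ l′ + l
  2l∸1≡l′+l = cong (λ m → l′ + suc m) (+-identityʳ l′)

  apex-index : toℕ apex ≡ l′ + l
  apex-index = trans (toℕ-fromℕ _) 2l∸1≡l′+l

  module _ {x y : Fin (2 * l)} where

    F2l-body : toℕ x ≢ toℕ apex → toℕ y ≢ toℕ apex → G x y ≡ closeℕ l′ (toℕ x) (toℕ y)
    F2l-body x≢apex y≢apex rewrite toℕ-fromℕ (2 * l ∸ 1) | ≡ᵇ-false x≢apex | ≡ᵇ-false y≢apex = refl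

    F2l-apexˡ : toℕ x ≡ toℕ apex → toℕ y ≢ toℕ apex → G x y ≡ (toℕ y <ᵇ t)
    F2l-apexˡ x≡apex y≢apex
      rewrite toℕ-fromℕ (2 * l ∸ 1) | x≡apex | ≡ᵇ-refl (2 * l ∸ 1) | ≡ᵇ-false y≢apex = refl

    F2l-apexʳ : toℕ x ≢ toℕ apex → toℕ y ≡ toℕ apex → G x y ≡ (toℕ x <ᵇ t)
    F2l-apexʳ x≢apex y≡apex
      rewrite toℕ-fromℕ (2 * l ∸ 1) | y≡apex | ≡ᵇ-refl (2 * l ∸ 1) | ≡ᵇ-false x≢apex = refl

    F2l-apex-loop : toℕ x ≡ toℕ apex → toℕ y ≡ toℕ apex → G x y ≡ false
    F2l-apex-loop x≡apex y≡apex rewrite toℕ-fromℕ (2 * l ∸ 1) | x≡apex | y≡apex | ≡ᵇ-refl (2 * l ∸ 1) = refl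

  <l⇒≢apex : ∀ {a} → a < l → a ≢ toℕ apex
  <l⇒≢apex {a} a<l a≡apex = <-irrefl (trans a≡apex apex-index) (<-≤-trans a<l (m≤n+m l l′))

  private

    body-index : ∀ (y : Fin (2 * l)) → toℕ y ≢ toℕ apex → toℕ y ≤ l′ + l′
    body-index y y≢apex =
      s≤s⁻¹ (subst (toℕ y <_) (trans apex-index (+-suc l′ l′)) (≤∧≢⇒< (≤fromℕ y) y≢apex))

  F2l-simple : IsSimple G
  F2l-simple = symmetric , loopless
    where
    symmetric : ∀ x y → G x y ≡ G y x
    symmetric x y with toℕ x ≟ toℕ apex | toℕ y ≟ toℕ apex
    ... | yes x≡apex | yes y≡apex = trans (F2l-apex-loop x≡apex y≡apex) (sym (F2l-apex-loop y≡apex x≡apex))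
    ... | yes x≡apex | no y≢apex  = trans (F2l-apexˡ x≡apex y≢apex) (sym (F2l-apexʳ y≢apex x≡apex))
    ... | no x≢apex  | yes y≡apex = trans (F2l-apexʳ x≢apex y≡apex) (sym (F2l-apexˡ y≡apex x≢apex))
    ... | no x≢apex  | no y≢apex  =
      trans (F2l-body x≢apex y≢apex) (trans (closeℕ-sym l′ (toℕ x) (toℕ y)) (sym (F2l-body y≢apex x≢apex)))
    loopless : ∀ x → G x x ≡ false
    loopless x with toℕ x ≟ toℕ apex
    ... | yes x≡apex = F2l-apex-loop x≡apex x≡apex
    ... | no x≢apex  = trans (F2l-body x≢apex x≢apex) (closeℕ-irrefl l′ (toℕ x))

  F2l-extends-A : ∀ x y → G (inject₁ x) (inject₁ y) ≡ A l x y
  F2l-extends-A x y = trans (F2l-body (body x) (body y)) (cong₂ (closeℕ l′) (toℕ-inject₁ x) (toℕ-inject₁ y))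
    where
    body : ∀ x → toℕ (inject₁ x) ≢ toℕ apex
    body x ι≡apex = <-irrefl (trans (sym (toℕ-inject₁ x)) (trans ι≡apex (toℕ-fromℕ _))) (toℕ<n x)

  F2l-apex-adjacent : ∀ {y} → toℕ y < t → toℕ y < l → T (G apex y)
  F2l-apex-adjacent y<t y<l = subst T (sym (F2l-apexˡ refl (<l⇒≢apex y<l))) (<⇒<ᵇ y<t)

  module _ {x y : Fin (2 * l)} where

    F2l-clique : toℕ x < l → toℕ y < l → toℕ x ≢ toℕ y → T (G x y)
    F2l-clique x<l y<l x≢y = subst T (sym (F2l-body (<l⇒≢apex x<l) (<l⇒≢apex y<l)))
      (closeℕ⁺ x≢y (≤-trans (m∸n≤m _ (toℕ y)) (s≤s⁻¹ x<l)) (≤-trans (m∸n≤m _ (toℕ x)) (s≤s⁻¹ y<l)))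

    F2l-middle-universal : toℕ x ≡ l′ → toℕ y ≢ toℕ apex → toℕ y ≢ l′ → T (G x y)
    F2l-middle-universal x≡l′ y≢apex y≢l′ =
      subst T (sym (F2l-body (λ x≡apex → <l⇒≢apex (≤-reflexive (cong suc x≡l′)) x≡apex) y≢apex))
        (subst (λ a → T (closeℕ l′ a (toℕ y))) (sym x≡l′)
          (closeℕ⁺ (λ l′≡y → y≢l′ (sym l′≡y)) (m∸n≤m l′ (toℕ y))
                   (m≤n+o⇒m∸n≤o (toℕ y) l′ (body-index y y≢apex))))

    F2l-far-from-apex : t ≤ toℕ x → toℕ x ≢ toℕ apex → toℕ y ≡ toℕ apex → ¬ T (G x y)
    F2l-far-from-apex t≤x x≢apex y≡apex Gxy = <⇒≱ (<ᵇ⇒< _ _ (subst T (F2l-apexʳ x≢apex y≡apex) Gxy)) t≤x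

    F2l-far-apart : l ≤ toℕ x → toℕ x ≢ toℕ apex → toℕ y ≡ 0 → ¬ T (G x y)
    F2l-far-apart l≤x x≢apex y≡0 Gxy with closeℕ⁻ {l′} {toℕ x} {toℕ y}
        (subst T (F2l-body x≢apex (λ y≡apex → <l⇒≢apex (subst (_< l) (sym y≡0) (s≤s z≤n)) y≡apex)) Gxy)
    ... | _ , x∸y≤l′ , _ = <⇒≱ l≤x (subst (_≤ l′) (cong (toℕ x ∸_) y≡0) x∸y≤l′)

-- A copy of F through the apex

withHead : (Fin n → Bool) → Fin n → List (Fin n)
withHead {n} p h = h ∷ filter (λ b → T? (p b ∧ not (b == h))) (allFin n)

module _ {p : Fin n → Bool} {h : Fin n} where

  ∈-withHead : ∀ {b} → T (p b) → b ∈ withHead p h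
  ∈-withHead {b} pb with b Fin.≟ h
  ... | yes refl = here refl
  ... | no b≢h   = there (∈-count⁺ (∈-allFin b , from T-∧ (pb , T-not⁺ (λ b==h → b≢h (==⇒≡ b==h)))))

  index-head : (h∈ : h ∈ withHead p h) → toℕ (index h∈) ≡ 0
  index-head (here _)   = refl
  index-head (there h∈) =
    ⊥-elim (T-not⁻ (proj₂ (to (T-∧ {p h}) (proj₂ (∈-count⁻ {xs = allFin n} h∈)))) (==-refl h))

length-withHead : (p : Fin n → Bool) (h : Fin n) → T (p h) → length (withHead p h) ≤ count p (allFin n)
length-withHead {n} p h ph =
  count-<-injection {p = λ b → p b ∧ not (b == h)} {q = p} (λ b → b) (Unique.allFin⁺ n)
    (λ (b∈ , h′) → b∈ , proj₁ (to T-∧ h′)) (λ _ _ b≡b′ → b≡b′)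
    (∈-allFin h , ph)
    (λ {b} (_ , h′) b≡h → T-not⁻ (proj₂ (to (T-∧ {p b}) h′)) (subst (λ c → T (b == c)) b≡h (==-refl b)))

index-injective : ∀ {X : Set} {xs : List X} {a b} (a∈ : a ∈ xs) (b∈ : b ∈ xs) →
                  toℕ (index a∈) ≡ toℕ (index b∈) → a ≡ b
index-injective {xs = xs} a∈ b∈ same =
  trans (lookup-index a∈) (trans (cong (List.lookup xs) (toℕ-injective same)) (sym (lookup-index b∈)))

module ApexEmbedding (F : Graph n) (F-simple : IsSimple F) {w x y : Fin n}
                     (w∼x : T (F w x)) (w≁y : ¬ T (F w y)) (y≢w : y ≢ w)
                     (l′ t : ℕ) (deg≤t : deg F w ≤ t) (n≤l′ : n ≤ l′) where

  private
    l = suc l′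
    G = F2l l t

    Inner Outer : List (Fin n)
    Inner = withHead (F w) x
    Outer = withHead (λ b → not (F w b)) y

    inner-index<deg : ∀ {a} (a∈ : a ∈ Inner) → toℕ (index a∈) < deg F w
    inner-index<deg a∈ = <-≤-trans (toℕ<n (index a∈)) (length-withHead (F w) x w∼x)

    outer-index+deg<l′ : ∀ {a} (a∈ : a ∈ Outer) → toℕ (index a∈) + deg F w < l′
    outer-index+deg<l′ a∈ = ≤-trans
      (+-monoˡ-< (deg F w) (<-≤-trans (toℕ<n (index a∈)) (length-withHead (λ b → not (F w b)) y (T-not⁺ w≁y))))
      (≤-trans (≤-reflexive (non-neighbours+deg≡n F w)) n≤l′)

    inner≢outer : ∀ {a b} (a∈ : a ∈ Inner) (b∈ : b ∈ Outer) → toℕ (index a∈) ≢ l′ ∸ toℕ (index b∈)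
    inner≢outer a∈ b∈ = <⇒≢ (<-≤-trans (inner-index<deg a∈)
      (m+n≤o⇒m≤o∸n (deg F w) (≤-trans (≤-reflexive (+-comm (deg F w) _)) (<⇒≤ (outer-index+deg<l′ b∈)))))

  -- The copy of F through the apex: w goes to the apex 2l, the neighbours of w to 1, …, deg w
  -- with x at 1, and the other vertices to a block ending at l with y at l.  Apart from the
  -- apex everything lands in {1, …, l}, a clique of F2l avoiding l + 1, …, 2l - 1.
  data Place (a : Fin n) : Set where
    centre : a ≡ w → Place a
    inner  : a ≢ w → T (F w a) → a ∈ Inner → Place a
    outer  : a ≢ w → ¬ T (F w a) → a ∈ Outer → Place a

  place : ∀ a → Place a
  place a with a Fin.≟ w | T? (F w a)
  ... | yes a≡w | _       = centre a≡w
  ... | no a≢w  | yes w∼a = inner a≢w w∼a (∈-withHead w∼a)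
  ... | no a≢w  | no w≁a  = outer a≢w w≁a (∈-withHead (T-not⁺ w≁a))

  code : ∀ {a} → Place a → ℕ
  code (centre _)     = 2 * l ∸ 1
  code (inner _ _ a∈) = toℕ (index a∈)
  code (outer _ _ a∈) = l′ ∸ toℕ (index a∈)

  code<l : ∀ {a} (c : Place a) → a ≢ w → code c < l
  code<l (centre a≡w)   a≢w = ⊥-elim (a≢w a≡w)
  code<l (inner _ _ a∈) _   = <-trans (inner-index<deg a∈) (<-trans (outer-index+deg<l′ (here refl)) (n<1+n l′))
  code<l (outer _ _ a∈) _   = s≤s (m∸n≤m l′ (toℕ (index a∈)))

  private
    body≢apex : ∀ {a} (c : Place a) → a ≢ w → code c ≢ 2 * l ∸ 1
    body≢apex c a≢w c≡apex = <l⇒≢apex l′ t (code<l c a≢w) (trans c≡apex (sym (toℕ-fromℕ _)))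

  code-injective : ∀ {a b} (c : Place a) (d : Place b) → code c ≡ code d → a ≡ b
  code-injective (centre a≡w) (centre b≡w) _ = trans a≡w (sym b≡w)
  code-injective (centre _) d@(inner b≢w _ _) same = ⊥-elim (body≢apex d b≢w (sym same))
  code-injective (centre _) d@(outer b≢w _ _) same = ⊥-elim (body≢apex d b≢w (sym same))
  code-injective c@(inner a≢w _ _) (centre _) same = ⊥-elim (body≢apex c a≢w same)
  code-injective c@(outer a≢w _ _) (centre _) same = ⊥-elim (body≢apex c a≢w same)
  code-injective (inner _ _ a∈) (inner _ _ b∈) same = index-injective a∈ b∈ same
  code-injective (outer _ _ a∈) (outer _ _ b∈) same =
    index-injective a∈ b∈ (∸-cancelˡ-≡ (index≤l′ a∈) (index≤l′ b∈) same)
    where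
    index≤l′ : ∀ {a} (a∈ : a ∈ Outer) → toℕ (index a∈) ≤ l′
    index≤l′ a∈ = ≤-trans (m≤m+n _ (deg F w)) (<⇒≤ (outer-index+deg<l′ a∈))
  code-injective (inner _ _ a∈) (outer _ _ b∈) same = ⊥-elim (inner≢outer a∈ b∈ same)
  code-injective (outer _ _ a∈) (inner _ _ b∈) same = ⊥-elim (inner≢outer b∈ a∈ (sym same))

  position : ∀ {a} → Place a → Fin (2 * l)
  position (centre _)         = apex l′ t
  position c@(inner a≢w _ _)  = fromℕ< (≤-trans (code<l c a≢w) (m≤m+n l _))
  position c@(outer a≢w _ _)  = fromℕ< (≤-trans (code<l c a≢w) (m≤m+n l _))

  toℕ-position : ∀ {a} (c : Place a) → toℕ (position c) ≡ code c
  toℕ-position (centre _)      = toℕ-fromℕ (2 * l ∸ 1)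
  toℕ-position (inner _ _ _)   = toℕ-fromℕ< _
  toℕ-position (outer _ _ _)   = toℕ-fromℕ< _

  position<l : ∀ {a} (c : Place a) → a ≢ w → toℕ (position c) < l
  position<l c a≢w = subst (_< l) (sym (toℕ-position c)) (code<l c a≢w)

  private
    apex-to-inner : ∀ {b} (d : Place b) → b ≢ w → T (F w b) → T (G (apex l′ t) (position d))
    apex-to-inner (centre b≡w)   b≢w _   = ⊥-elim (b≢w b≡w)
    apex-to-inner d@(inner _ _ b∈) b≢w _ = F2l-apex-adjacent l′ t
      (subst (_< t) (sym (toℕ-position d)) (<-≤-trans (inner-index<deg b∈) deg≤t)) (position<l d b≢w)
    apex-to-inner (outer _ w≁b _) _ w∼b  = ⊥-elim (w≁b w∼b)

    body-edge : ∀ {a b} (c : Place a) (d : Place b) → a ≢ w → b ≢ w → T (F a b) → T (G (position c) (position d))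
    body-edge {a} c d a≢w b≢w Fab = F2l-clique l′ t (position<l c a≢w) (position<l d b≢w)
      (λ same → simple⇒irrefl F-simple (subst (λ b → T (F a b)) (sym (code-injective c d
        (trans (sym (toℕ-position c)) (trans same (toℕ-position d))))) Fab))

  position-adjacent : ∀ {a b} (c : Place a) (d : Place b) → T (F a b) → T (G (position c) (position d))
  position-adjacent (centre refl) (centre refl)       Faa = ⊥-elim (simple⇒irrefl F-simple Faa)
  position-adjacent (centre refl) d@(inner b≢w _ _)   Fwb = apex-to-inner d b≢w Fwb
  position-adjacent (centre refl) d@(outer b≢w _ _)   Fwb = apex-to-inner d b≢w Fwb
  position-adjacent c@(inner a≢w _ _) (centre refl)   Faw =
    simple⇒sym (F2l-simple l′ t) {apex l′ t} {position c} (apex-to-inner c a≢w (simple⇒sym F-simple Faw))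
  position-adjacent c@(outer a≢w _ _) (centre refl)   Faw =
    simple⇒sym (F2l-simple l′ t) {apex l′ t} {position c} (apex-to-inner c a≢w (simple⇒sym F-simple Faw))
  position-adjacent c@(inner a≢w _ _) d@(inner b≢w _ _) Fab = body-edge c d a≢w b≢w Fab
  position-adjacent c@(inner a≢w _ _) d@(outer b≢w _ _) Fab = body-edge c d a≢w b≢w Fab
  position-adjacent c@(outer a≢w _ _) d@(inner b≢w _ _) Fab = body-edge c d a≢w b≢w Fab
  position-adjacent c@(outer a≢w _ _) d@(outer b≢w _ _) Fab = body-edge c d a≢w b≢w Fab

  embedding : Vec (Fin (2 * l)) n
  embedding = tabulate (λ a → position (place a))

  lookup-embedding : ∀ a → lookup embedding a ≡ position (place a)
  lookup-embedding = lookup∘tabulate _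

  embedding-isEmbedding : IsEmbedding F G embedding
  embedding-isEmbedding = record
    { injective = λ {a} {b} same → code-injective (place a) (place b) (begin
        code (place a)              ≡⟨ toℕ-position (place a) ⟨
        toℕ (position (place a))    ≡⟨ cong toℕ (lookup-embedding a) ⟨
        toℕ (lookup embedding a)    ≡⟨ cong toℕ same ⟩
        toℕ (lookup embedding b)    ≡⟨ cong toℕ (lookup-embedding b) ⟩
        toℕ (position (place b))    ≡⟨ toℕ-position (place b) ⟩
        code (place b)              ∎)
    ; adjacent  = λ {a} {b} Fab → subst₂ (λ u v → T (G u v)) (sym (lookup-embedding a)) (sym (lookup-embedding b))
                    (position-adjacent (place a) (place b) Fab)
    }
    where open ≡-Reasoning

  toℕ-embedding : ∀ a → toℕ (lookup embedding a) ≡ code (place a)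
  toℕ-embedding a = trans (cong toℕ (lookup-embedding a)) (toℕ-position (place a))

  embedding-x : toℕ (lookup embedding x) ≡ 0
  embedding-x = trans (toℕ-embedding x) (at-x (place x))
    where
    at-x : (c : Place x) → code c ≡ 0
    at-x (centre refl)      = ⊥-elim (simple⇒irrefl F-simple w∼x)
    at-x (inner _ _ x∈)     = index-head x∈
    at-x (outer _ w≁x _)    = ⊥-elim (w≁x w∼x)

  embedding-y : toℕ (lookup embedding y) ≡ l′
  embedding-y = trans (toℕ-embedding y) (at-y (place y))
    where
    at-y : (c : Place y) → code c ≡ l′
    at-y (centre y≡w)       = ⊥-elim (y≢w y≡w)
    at-y (inner _ w∼y _)    = ⊥-elim (w≁y w∼y)
    at-y (outer _ _ y∈)     = cong (l′ ∸_) (index-head y∈)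

  embedding-w : lookup embedding w ≡ apex l′ t
  embedding-w = trans (lookup-embedding w) (at-w (place w))
    where
    at-w : (c : Place w) → position c ≡ apex l′ t
    at-w (centre _)         = refl
    at-w (inner w≢w _ _)    = ⊥-elim (w≢w refl)
    at-w (outer w≢w _ _)    = ⊥-elim (w≢w refl)

  embedding-range : ∀ a → toℕ (lookup embedding a) < l ⊎ lookup embedding a ≡ apex l′ t
  embedding-range a = subst (λ v → toℕ v < l ⊎ v ≡ apex l′ t) (sym (lookup-embedding a)) (range (place a))
    where
    range : ∀ {a} (c : Place a) → toℕ (position c) < l ⊎ position c ≡ apex l′ t
    range (centre _)           = inj₂ refl
    range c@(inner a≢w _ _)    = inj₁ (position<l c a≢w)
    range c@(outer a≢w _ _)    = inj₁ (position<l c a≢w)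

private
  +[m+n]-+m≡+n : ∀ m n → + (m + n) - + m ≡ + n
  +[m+n]-+m≡+n m n = trans ([+m]-[+n]≡m⊖n (m + n) m) (trans (≤-⊖ (m≤m+n m n)) (cong +_ (m+n∸m≡n m n)))

δ≡Fdeg₂-apex : ∀ {n} (F : Graph n) (l′ t : ℕ) (x : Fin (2 * suc l′ ∸ 1)) →
                 δ F (suc l′) t (suc (toℕ x)) ≡ + Fdeg₂ F (F2l (suc l′) t) (inject₁ x) (apex l′ t)
δ≡Fdeg₂-apex F l′ t x = begin
  + FdegAt F G (suc (toℕ x)) - + FdegAt F H (suc (toℕ x))
    ≡⟨ cong₂ (λ a b → + a - + b) (FdegAt≡Fdeg F G (cong suc (toℕ-inject₁ x))) (FdegAt≡Fdeg F H refl) ⟩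
  + Fdeg F G (inject₁ x) - + Fdeg F H x
    ≡⟨ cong (λ a → + a - + Fdeg F H x) (Fdeg-extension F G H (F2l-extends-A l′ t) x) ⟩
  + (Fdeg F H x + Fdeg₂ F G (inject₁ x) (apex l′ t)) - + Fdeg F H x
    ≡⟨ +[m+n]-+m≡+n (Fdeg F H x) _ ⟩
  + Fdeg₂ F G (inject₁ x) (apex l′ t) ∎
  where
  open ≡-Reasoning
  G = F2l (suc l′) t
  H = A (suc l′)

module _ {n} (F : Graph n) (F-simple : IsSimple F) {t} (cherry : InducedCherry F t)
         (l′ : ℕ) (t<n : t < n) (n≤l′ : n ≤ l′) where

  open InducedCherry cherry
  open ApexEmbedding F F-simple w∼x w≁y y≢w l′ t deg≤t n≤l′

  private
    l = suc l′
    G = F2l l t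

    ≢-by-toℕ : ∀ {a b : Fin (2 * l)} → toℕ a ≢ toℕ b → a ≢ b
    ≢-by-toℕ toℕa≢toℕb a≡b = toℕa≢toℕb (cong toℕ a≡b)

  Fdeg₂-apex-right<middle : ∀ {i′} (p q : Fin (2 * l)) → toℕ p ≡ i′ → toℕ q ≡ l′ → l ≤ i′ → i′ < l′ + t →
                    Fdeg₂ F G p (apex l′ t) < Fdeg₂ F G q (apex l′ t)
  Fdeg₂-apex-right<middle {i′} p q p≡i′ q≡l′ l≤i′ i′<l′+t =
    Fdeg₂-dominated<dominating F G (F2l-simple l′ t) {p} {q} {Fin.zero} {apex l′ t}
      (≢-by-toℕ (λ 0≡p → <⇒≢ (<-≤-trans (s≤s z≤n) l≤i′) (trans 0≡p p≡i′)))
      (≢-by-toℕ (λ 0≡q → <⇒≢ (<-≤-trans (s≤s z≤n) (<-≤-trans t<n n≤l′)) (trans 0≡q q≡l′)))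
      (≢-by-toℕ (λ apex≡p → p≢apex (sym apex≡p)))
      (≢-by-toℕ (λ apex≡q → <⇒≢ (m<m+n l′ (s≤s z≤n))
                                  (trans (sym q≡l′) (trans (sym apex≡q) (apex-index l′ t)))))
      q-dominates-p
      (F2l-far-apart l′ t (subst (l ≤_) (sym p≡i′) l≤i′) p≢apex refl)
      (∈-copies⁺ embedding-isEmbedding)
      (subst (λ v → T (hasVertex S₀ v)) e[y]≡q (image-vertex⁺ F embedding y))
      (subst (λ v → T (hasVertex S₀ v)) embedding-w (image-vertex⁺ F embedding w))
      S₀∌p
      (subst₂ (λ u v → T (hasEdge S₀ u v)) e[y]≡q e[x]≡0 (image-edge⁺ F embedding (simple⇒sym F-simple x∼y)))
    where
    S₀ = image F embedding
    t≤l′ : t ≤ l′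
    t≤l′ = <⇒≤ (<-≤-trans t<n n≤l′)
    p≢apex : toℕ p ≢ toℕ (apex l′ t)
    p≢apex p≡apex = <⇒≢ (<-≤-trans i′<l′+t (+-monoʳ-≤ l′ (≤-trans t≤l′ (n≤1+n l′))))
                        (trans (sym p≡i′) (trans p≡apex (apex-index l′ t)))
    e[y]≡q : lookup embedding y ≡ q
    e[y]≡q = toℕ-injective (trans embedding-y (sym q≡l′))
    e[x]≡0 : lookup embedding x ≡ Fin.zero
    e[x]≡0 = toℕ-injective embedding-x
    q-dominates-p : ∀ v → v ≢ q → T (G p v) → T (G q v)
    q-dominates-p v v≢q Gpv with toℕ v ≟ toℕ (apex l′ t)
    ... | yes v≡apex = ⊥-elim
      (F2l-far-from-apex l′ t (subst (t ≤_) (sym p≡i′) (≤-trans t≤l′ (<⇒≤ l≤i′))) p≢apex v≡apex Gpv)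
    ... | no v≢apex  =
      F2l-middle-universal l′ t q≡l′ v≢apex (λ v≡l′ → v≢q (toℕ-injective (trans v≡l′ (sym q≡l′))))
    S₀∌p : ¬ T (hasVertex S₀ p)
    S₀∌p S₀∋p with image-vertex⁻ F embedding S₀∋p
    ... | a , e[a]≡p with embedding-range a
    ... | inj₁ e[a]<l   = <⇒≱ e[a]<l (subst (l ≤_) (sym (trans (cong toℕ e[a]≡p) p≡i′)) l≤i′)
    ... | inj₂ e[a]≡apex = p≢apex (cong toℕ (trans (sym e[a]≡p) e[a]≡apex))

  δ-right<middle : ∀ {i′} → l ≤ i′ → i′ < l′ + t → δ F l t (suc i′) <ℤ δ F l t l
  δ-right<middle {i′} l≤i′ i′<l′+t = subst₂ _<ℤ_ (δ-at i′<2l-1) (δ-at l′<2l-1)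
    (+<+ (Fdeg₂-apex-right<middle _ _ (toℕ-vertex i′<2l-1) (toℕ-vertex l′<2l-1) l≤i′ i′<l′+t))
    where
    i′<2l-1 : i′ < 2 * l ∸ 1
    i′<2l-1 = subst (i′ <_) (sym (2l∸1≡l′+l l′ t))
      (<-≤-trans i′<l′+t (+-monoʳ-≤ l′ (≤-trans (<⇒≤ (<-≤-trans t<n n≤l′)) (n≤1+n l′))))
    l′<2l-1 : l′ < 2 * l ∸ 1
    l′<2l-1 = subst (l′ <_) (sym (2l∸1≡l′+l l′ t)) (m<m+n l′ (s≤s z≤n))
    toℕ-vertex : ∀ {j} (j<2l-1 : j < 2 * l ∸ 1) → toℕ (inject₁ (fromℕ< j<2l-1)) ≡ j
    toℕ-vertex j<2l-1 = trans (toℕ-inject₁ _) (toℕ-fromℕ< j<2l-1)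
    δ-at : ∀ {j} (j<2l-1 : j < 2 * l ∸ 1) → + Fdeg₂ F G (inject₁ (fromℕ< j<2l-1)) (apex l′ t) ≡ δ F l t (suc j)
    δ-at j<2l-1 =
      trans (sym (δ≡Fdeg₂-apex F l′ t (fromℕ< j<2l-1))) (cong (λ k → δ F l t (suc k)) (toℕ-fromℕ< j<2l-1))

lemma11 : (n : ℕ) (F : Graph n) → IsSimple F → HasDiameter2 F →
          (t : ℕ) → t ≡ minDeg F → 2 ≤ t →
          (l : ℕ) → n < l →
          (i : ℕ) → l + 1 ≤ i → i ≤ l + t ∸ 1 →
          δ F l t i <ℤ δ F l t l
-- 2 ≤ t only makes the range of i nonempty; the argument does not need it.
lemma11 n F F-simple F-diameter-2 t t≡minDeg _ (suc l′) (s≤s n≤l′) (suc i′) (s≤s l′+1≤i′) i′<l′+t =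
  δ-right<middle F F-simple cherry l′ t<n n≤l′ (subst (_≤ i′) (+-comm l′ 1) l′+1≤i′) i′<l′+t
  where
  cherry : InducedCherry F t
  cherry = subst (InducedCherry F) (sym t≡minDeg) (minimum-degree-cherry F F-simple F-diameter-2)
  t<n : t < n
  t<n = subst (_< n) (sym t≡minDeg) (<-≤-trans (m<m+n (minDeg F) (s≤s z≤n)) (minDeg+2≤n F F-simple F-diameter-2))
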